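{- For every sequence set $X\subseteq B^n$ with $|X| > n+1$, we have $s(X)\ge 1$.
   Context: $B=\{0,1\}$. A comparator $[i,j]$ ($i\ne j\in\{1,\dots,n\}$) maps $x\in B^n$ to the sequence obtained by replacing $x_i$ by $\min(x_i,x_j)$ and $x_j$ by $\max(x_i,x_j)$; an exchange $(i,j)$ swaps entries $i$ and $j$. A comparator network on $n$ channels is a finite sequence of comparators and exchanges applied left to right; its size is its number of comparators. For $X\subseteq B^n$, $s(X)$ is the minimal size of a comparator network whose output on every $x\in X$ is sorted (nondecreasing). -}

module Defs where

open import Data.Nat using (ℕ; zero; suc; _≤_)
open import Data.Bool using (Bool; true; false; _∧_; _∨_)
import Data.Bool as Bool
open import Data.Fin using (Fin)
import Data.Fin as Fin
open import Data.Vec using (Vec; lookup; _[_]≔_)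
open import Data.List using (List; []; _∷_; length)
open import Data.List.Membership.Propositional using (_∈_)
open import Relation.Binary.PropositionalEquality using (_≢_)

BSeq : ℕ → Set
BSeq n = Vec Bool n

data Gate (n : ℕ) : Set where
  comp : (i j : Fin n) → i ≢ j → Gate n
  exch : (i j : Fin n) → i ≢ j → Gate n

Network : ℕ → Set
Network n = List (Gate n)

applyGate : ∀ {n} → Gate n → BSeq n → BSeq n
applyGate (comp i j _) x =
  (x [ i ]≔ (lookup x i ∧ lookup x j)) [ j ]≔ (lookup x i ∨ lookup x j)
applyGate (exch i j _) x =
  (x [ i ]≔ lookup x j) [ j ]≔ lookup x i

run : ∀ {n} → Network n → BSeq n → BSeq n
run []       x = x
run (g ∷ gs) x = run gs (applyGate g x)

size : ∀ {n} → Network n → ℕ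
size []                  = zero
size (comp _ _ _ ∷ gs)   = suc (size gs)
size (exch _ _ _ ∷ gs)   = size gs

Sorted : ∀ {n} → BSeq n → Set
Sorted {n} x = ∀ (i j : Fin n) → i Fin.≤ j → lookup x i Bool.≤ lookup x j

Sorts : ∀ {n} → Network n → List (BSeq n) → Set
Sorts N X = ∀ x → x ∈ X → Sorted (run N x)

-- s(X) ≥ m : every network sorting X has at least m comparators
-- (s(X) is the minimum of size over sorting networks for X, which always exist).
sAtLeast : ∀ {n} → List (BSeq n) → ℕ → Set
sAtLeast X m = ∀ N → Sorts N X → m ≤ size N

{-# OPTIONS --safe #-}
-- A network without comparators only permutes channels, so it is injective on B^n.
-- A sorted sequence is determined by its number of ones, which takes one of n+1
-- values; by pigeonhole, two of the more than n+1 distinct inputs get the same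
-- sorted output, which injectivity forbids.
module Submission where

open import Defs
open import Data.Nat using (ℕ; suc; _<_)
open import Data.List using (List; length)
open import Data.List.Relation.Unary.Unique.Propositional using (Unique)

import Data.Nat as ℕ
open import Data.Nat.Properties using (suc-injective; n≢0⇒n>0; ≤⇒≯; ≤-reflexive)
open import Data.Bool using (true; false; T?)
open import Data.Fin using (Fin; zero; suc; fromℕ<; toℕ)
import Data.Fin as Fin
open import Data.Fin.Properties using (_≟_; pigeonhole; toℕ-fromℕ<)
open import Data.Vec using (Vec; []; _∷_; lookup; _[_]≔_; count)
open import Data.Vec.Properties
  using (lookup∘update; lookup∘update′; tabulate∘lookup; tabulate-cong; count≤n)
import Data.List as List
open import Data.List.Membership.Propositional.Properties using (∈-lookup)
open import Data.List.Relation.Unary.AllPairs using (_∷_)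
import Data.List.Relation.Unary.All as All
open import Data.Product using (_,_)
open import Data.Empty using (⊥-elim)
open import Function.Definitions using (Injective)
open import Relation.Binary.PropositionalEquality
open import Relation.Nullary using (yes; no)

lookup-ext : ∀ {A : Set} {n} {x y : Vec A n} → (∀ k → lookup x k ≡ lookup y k) → x ≡ y
lookup-ext {x = x} {y} x≗y =
  trans (sym (tabulate∘lookup x)) (trans (tabulate-cong x≗y) (tabulate∘lookup y))

exch-involutive : ∀ {n} (i j : Fin n) (i≢j : i ≢ j) (x : BSeq n) →
  applyGate (exch i j i≢j) (applyGate (exch i j i≢j) x) ≡ x
exch-involutive i j i≢j x = lookup-ext lookup-swap²
  where
  swap : BSeq _ → BSeq _
  swap = applyGate (exch i j i≢j)

  lookup-swap-j : ∀ z → lookup (swap z) j ≡ lookup z i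
  lookup-swap-j z = lookup∘update j (z [ i ]≔ lookup z j) (lookup z i)

  lookup-swap-i : ∀ z → lookup (swap z) i ≡ lookup z j
  lookup-swap-i z = trans (lookup∘update′ i≢j (z [ i ]≔ lookup z j) (lookup z i)) (lookup∘update i z (lookup z j))

  lookup-swap-other : ∀ z k → k ≢ i → k ≢ j → lookup (swap z) k ≡ lookup z k
  lookup-swap-other z k k≢i k≢j =
    trans (lookup∘update′ k≢j (z [ i ]≔ lookup z j) (lookup z i)) (lookup∘update′ k≢i z (lookup z j))

  lookup-swap² : ∀ k → lookup (swap (swap x)) k ≡ lookup x k
  lookup-swap² k with k ≟ i | k ≟ j
  ... | yes refl | _        = trans (lookup-swap-i (swap x)) (lookup-swap-j x)
  ... | no _     | yes refl = trans (lookup-swap-j (swap x)) (lookup-swap-i x)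
  ... | no k≢i   | no k≢j   =
    trans (lookup-swap-other (swap x) k k≢i k≢j) (lookup-swap-other x k k≢i k≢j)

run-injective : ∀ {n} (N : Network n) → size N ≡ 0 → Injective _≡_ _≡_ (run N)
run-injective List.[]                   _      eq = eq
run-injective (comp _ _ _ List.∷ _)     ()
run-injective (exch i j i≢j List.∷ N) size≡0 {x} {y} eq = begin
  x                   ≡⟨ sym (exch-involutive i j i≢j x) ⟩
  swap (swap x)       ≡⟨ cong swap (run-injective N size≡0 eq) ⟩
  swap (swap y)       ≡⟨ exch-involutive i j i≢j y ⟩
  y                   ∎
  where
  open ≡-Reasoning
  swap : BSeq _ → BSeq _
  swap = applyGate (exch i j i≢j)

ones : ∀ {n} → BSeq n → ℕ
ones = count T?

Sorted-tail : ∀ {n} {b} {xs : BSeq n} → Sorted (b ∷ xs) → Sorted xs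
Sorted-tail sorted i j i≤j = sorted (suc i) (suc j) (ℕ.s≤s i≤j)

Sorted-true∷⇒ones≡length : ∀ {n} (xs : BSeq n) → Sorted (true ∷ xs) → ones xs ≡ n
Sorted-true∷⇒ones≡length []           _      = refl
Sorted-true∷⇒ones≡length (true ∷ xs)  sorted =
  cong suc (Sorted-true∷⇒ones≡length xs (Sorted-tail sorted))
Sorted-true∷⇒ones≡length (false ∷ xs) sorted with sorted zero (suc zero) ℕ.z≤n
... | ()

Sorted-ones-injective : ∀ {n} {x y : BSeq n} → Sorted x → Sorted y → ones x ≡ ones y → x ≡ y
Sorted-ones-injective {x = []}         {[]}         _  _  _  = refl
Sorted-ones-injective {x = true ∷ xs}  {true ∷ ys}  sx sy eq =
  cong (true ∷_) (Sorted-ones-injective (Sorted-tail sx) (Sorted-tail sy) (suc-injective eq))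
Sorted-ones-injective {x = false ∷ xs} {false ∷ ys} sx sy eq =
  cong (false ∷_) (Sorted-ones-injective (Sorted-tail sx) (Sorted-tail sy) eq)
Sorted-ones-injective {x = true ∷ xs}  {false ∷ ys} sx _  eq =
  ⊥-elim (≤⇒≯ (count≤n T? ys)
    (≤-reflexive (trans (cong suc (sym (Sorted-true∷⇒ones≡length xs sx))) eq)))
Sorted-ones-injective {x = false ∷ xs} {true ∷ ys}  _  sy eq =
  ⊥-elim (≤⇒≯ (count≤n T? xs)
    (≤-reflexive (trans (cong suc (sym (Sorted-true∷⇒ones≡length ys sy))) (sym eq))))

Unique-lookup-distinct : ∀ {A : Set} {X : List A} → Unique X →
  ∀ {i j : Fin (length X)} → i Fin.< j → List.lookup X i ≢ List.lookup X j
Unique-lookup-distinct (x∉X ∷ _) {zero}  {suc j} _ = All.lookup x∉X (∈-lookup j)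
Unique-lookup-distinct (_ ∷ uniq) {suc i} {suc j} (ℕ.s≤s i<j) =
  Unique-lookup-distinct uniq i<j

mainTheorem5 : (n : ℕ) (X : List (BSeq n)) → Unique X →
    suc n < length X → sAtLeast X 1
mainTheorem5 n X uniq n+1<|X| N sorts = n≢0⇒n>0 λ size≡0 →
  let output : Fin (length X) → BSeq n
      output k = run N (List.lookup X k)
      onesOfOutput : Fin (length X) → Fin (suc n)
      onesOfOutput k = fromℕ< (ℕ.s≤s (count≤n T? (output k)))
      (i , j , i<j , same) = pigeonhole n+1<|X| onesOfOutput
      sameOnes : ones (output i) ≡ ones (output j)
      sameOnes = trans (sym (toℕ-fromℕ< _)) (trans (cong toℕ same) (toℕ-fromℕ< _))
      sameOutput : output i ≡ output j
      sameOutput = Sorted-ones-injective (sorts _ (∈-lookup i)) (sorts _ (∈-lookup j)) sameOnes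
  in Unique-lookup-distinct uniq i<j (run-injective N size≡0 sameOutput)
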